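{- For integers $n,k \geqslant 1$, let $\mathfrak{A}_{n,k}$ be the set of words $\omega = (\omega_1, \dots, \omega_n)$ of length $n$ over the alphabet $\{1, \dots, k\}$ such that $\omega$ avoids the pattern $010$, every letter of $\{1, \dots, k\}$ occurs in $\omega$, and $\omega_1 = k$. Let $\mathfrak{a}_{n,k} = \#\mathfrak{A}_{n,k}$. Then for all $n,k \geqslant 1$, $$\mathfrak{a}_{n,k} = \left[ {n \atop n+1-k} \right],$$ where $\left[ {a \atop b} \right]$ denotes the unsigned Stirling number of the first kind.
   Context: A word (finite sequence of integers) $\sigma=(\sigma_1,\dots,\sigma_n)$ contains a pattern $p=(p_1,\dots,p_k)$ if some subsequence $(\sigma_{i_1},\dots,\sigma_{i_k})$ with $i_1<\dots<i_k$ is order-isomorphic to $p$ (i.e. $\sigma_{i_a}<\sigma_{i_b}$ iff $p_a<p_b$ and $\sigma_{i_a}=\sigma_{i_b}$ iff $p_a=p_b$); otherwise $\sigma$ avoids $p$. Thus avoiding $010$ means there are no indices $a<b<c$ with $\sigma_a=\sigma_c<\sigma_b$. The unsigned Stirling number of the first kind $\left[ {n \atop j} \right]$ counts permutations of $n$ elements with exactly $j$ cycles; in particular $\left[ {n \atop j} \right]=0$ for $n\geqslant 1$ and $j\leqslant 0$. -}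

module Defs where

open import Data.Nat using (ℕ; zero; suc; _+_; _*_)
open import Data.Fin using (Fin; _<_; toℕ; fromℕ)
open import Data.Fin.Properties using (all?; any?) renaming (_≟_ to _≟F_)
open import Data.Vec using (Vec; lookup; []; _∷_)
open import Data.List using (List; []; _∷_; concatMap; map; filter; length; allFin)
open import Data.Product using (Σ; _×_; _,_)
open import Relation.Nullary using (¬_; Dec)
open import Relation.Binary.PropositionalEquality using (_≡_)
open import Relation.Nullary.Decidable using (_×-dec_; ¬?)
import Data.Fin as F

-- Words of length n over the alphabet {1,…,k}; the letter j ∈ {1,…,k}
-- is represented by the element j-1 of Fin k (an order isomorphism).
Word : ℕ → ℕ → Set
Word n k = Vec (Fin k) n

Contains010 : ∀ {n k} → Word n k → Set
Contains010 {n} ω = Σ (Fin n) λ a → Σ (Fin n) λ b → Σ (Fin n) λ c →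
  (a < b) × (b < c) × (lookup ω a ≡ lookup ω c) × (lookup ω a < lookup ω b)

Avoids010 : ∀ {n k} → Word n k → Set
Avoids010 ω = ¬ Contains010 ω

Surjective : ∀ {n k} → Word n k → Set
Surjective {n} {k} ω = ∀ (x : Fin k) → Σ (Fin n) λ i → lookup ω i ≡ x

-- membership in 𝔄_{n+1,k+1}: avoids 010, uses every letter, first letter is k+1
InA : ∀ n k → Word (suc n) (suc k) → Set
InA n k ω = Avoids010 ω × Surjective ω × (lookup ω F.zero ≡ fromℕ k)

contains010? : ∀ {n k} (ω : Word n k) → Dec (Contains010 ω)
contains010? ω = any? λ a → any? λ b → any? λ c →
  (a F.<? b) ×-dec ((b F.<? c) ×-dec ((lookup ω a ≟F lookup ω c) ×-dec (lookup ω a F.<? lookup ω b)))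

surjective? : ∀ {n k} (ω : Word n k) → Dec (Surjective ω)
surjective? ω = all? λ x → any? λ i → lookup ω i ≟F x

inA? : ∀ n k (ω : Word (suc n) (suc k)) → Dec (InA n k ω)
inA? n k ω = ¬? (contains010? ω) ×-dec (surjective? ω ×-dec (lookup ω F.zero ≟F fromℕ k))

allWords : ∀ n k → List (Word n k)
allWords zero k = [] ∷ []
allWords (suc n) k = concatMap (λ x → map (x ∷_) (allWords n k)) (allFin k)

countA : ℕ → ℕ → ℕ
countA n k = length (filter (inA? n k) (allWords (suc n) (suc k)))

stirling1 : ℕ → ℕ → ℕ
stirling1 zero zero = 1
stirling1 zero (suc j) = 0
stirling1 (suc n) zero = 0
stirling1 (suc n) (suc j) = n * stirling1 n (suc j) + stirling1 n j

{-# OPTIONS --safe #-}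

-- In a word of 𝔄_{n+1,k+1} the occurrences of the smallest letter form a
-- single block (a larger letter between two of them would give a 010), and
-- the block does not start the word.  Deleting the first letter of the block
-- gives a word of 𝔄_{n,k+1} if the block has length at least 2; otherwise,
-- after decreasing the remaining letters, it gives a word of 𝔄_{n,k} together
-- with one of n possible positions of the deleted letter.  Hence
-- 𝔞_{n+1,k+1} = 𝔞_{n,k+1} + n 𝔞_{n,k}, which together with 𝔞_{n,1} = 1 and
-- 𝔞_{1,k+1} = 0 is the recurrence of [n, n+1-k].
module Submission where

open import Defs
open import Data.Nat using (ℕ; suc; _+_; _∸_)
open import Relation.Binary.PropositionalEquality using (_≡_)

open import Data.Bool using (true; false)
open import Data.Nat as ℕ using (zero; _*_; z≤n; s≤s; z<s; s<s)
import Data.Nat.Properties as ℕₚ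
open import Data.Nat.ListAction using (sum)
open import Data.Fin as Fin using (Fin; zero; suc; _≤_; _<_; fromℕ; inject₁; punchIn; punchOut; pinch)
open import Data.Fin.Properties
  using (_≟_; any?; suc-injective; inject₁-injective; 0≢1+n; <⇒≢; <-irrefl; <-asym; <-trans; ≤-refl;
         ≤∧≢⇒<; ≤fromℕ; punchIn-mono-≤; punchIn-punchOut; pinch-mono-≤; +↔⊎; *↔×; 1↔⊤)
open import Data.Fin.Permutation using (↔⇒≡)
open import Data.Vec using (Vec; []; _∷_; lookup; insertAt; removeAt; map; replicate)
open import Data.Vec.Properties
  using (insertAt-lookup; insertAt-punchIn; removeAt-insertAt; lookup-map; ∷-injectiveˡ; ∷-injectiveʳ)
open import Data.List as List using (List; []; _∷_; _++_; length; filter; concatMap; allFin; tabulate)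
open import Data.List.Properties using (filter-++; length-++; map-tabulate; tabulate-cong; filter-none)
import Data.List.Relation.Unary.All as All
open import Data.Product as Product using (Σ; ∃; ∃₂; _×_; _,_; proj₁; proj₂)
open import Data.Product.Function.Dependent.Propositional using (Σ-↔)
open import Data.Product.Function.NonDependent.Propositional using (_×-↔_)
open import Data.Sum using (_⊎_; inj₁; inj₂)
open import Data.Sum.Function.Propositional using (_⊎-↔_)
open import Data.Unit using (⊤)
open import Data.Empty using (⊥-elim; ⊥-elim-irr)
open import Data.Irrelevant as Irrelevant using (Irrelevant; [_])
open import Data.Refinement using (Refinement-syntax; _,_; value; value-injective)
open import Function.Base using (_∘_; id)
open import Function.Bundles using (_↔_; mk↔ₛ′; mk⤖)
open import Function.Definitions using (Injective; StrictlySurjective)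
open import Function.Consequences.Propositional using (strictlySurjective⇒surjective)
open import Function.Properties.Inverse using (↔-refl; ↔-sym; ↔-trans)
open import Function.Properties.Bijection using (⤖⇒↔)
import Function.Related.Propositional as Related
open import Relation.Binary.Definitions using (Monotonic₁)
open import Relation.Binary.PropositionalEquality
  using (refl; sym; trans; cong; cong₂; subst; subst₂; _≢_; ≢-sym; module ≡-Reasoning)
open import Relation.Nullary using (¬_; does; yes; no)
open import Relation.Nullary.Decidable using (recompute)
open import Relation.Unary using (Decidable)

-- Counting words by a decidable predicate

module _ {A : Set} {P : A → Set} (P? : Decidable P) where

  length-filter-concatMap : ∀ {B : Set} (f : B → List A) xs →
    length (filter P? (concatMap f xs)) ≡ sum (List.map (length ∘ filter P? ∘ f) xs)
  length-filter-concatMap f []       = refl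
  length-filter-concatMap f (x ∷ xs) = begin
    length (filter P? (f x ++ concatMap f xs))                     ≡⟨ cong length (filter-++ P? (f x) _) ⟩
    length (filter P? (f x) ++ filter P? (concatMap f xs))         ≡⟨ length-++ (filter P? (f x)) ⟩
    length (filter P? (f x)) + length (filter P? (concatMap f xs))
      ≡⟨ cong (length (filter P? (f x)) +_) (length-filter-concatMap f xs) ⟩
    sum (List.map (length ∘ filter P? ∘ f) (x ∷ xs))               ∎
    where open ≡-Reasoning

  length-filter-map : ∀ {B : Set} (f : B → A) xs →
    length (filter P? (List.map f xs)) ≡ length (filter (P? ∘ f) xs)
  length-filter-map f []       = refl
  length-filter-map f (x ∷ xs) with does (P? (f x))
  ... | true  = cong suc (length-filter-map f xs)
  ... | false = length-filter-map f xs

length-filter-allWords-suc : ∀ n k {P : Word (suc n) k → Set} (P? : Decidable P) →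
  length (filter P? (allWords (suc n) k)) ≡ sum (tabulate λ x → length (filter (P? ∘ (x ∷_)) (allWords n k)))
length-filter-allWords-suc n k P? = begin
  length (filter P? (concatMap (λ x → List.map (x ∷_) (allWords n k)) (allFin k)))
    ≡⟨ length-filter-concatMap P? _ (allFin k) ⟩
  sum (List.map count-with (allFin k))
    ≡⟨ cong sum (map-tabulate id count-with) ⟩
  sum (tabulate count-with)
    ≡⟨ cong sum (tabulate-cong λ x → length-filter-map P? (x ∷_) (allWords n k)) ⟩
  sum (tabulate λ x → length (filter (P? ∘ (x ∷_)) (allWords n k)))
    ∎
  where
  open ≡-Reasoning
  count-with : Fin k → ℕ
  count-with x = length (filter P? (List.map (x ∷_) (allWords n k)))

Σ-Fin-↔ : ∀ {k} (c : Fin k → ℕ) → Σ (Fin k) (Fin ∘ c) ↔ Fin (sum (tabulate c))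
Σ-Fin-↔ {zero}  c = mk↔ₛ′ (λ ()) (λ ()) (λ ()) (λ ())
Σ-Fin-↔ {suc k} c = ↔-trans split (↔-trans (↔-refl ⊎-↔ Σ-Fin-↔ (c ∘ suc)) (↔-sym +↔⊎))
  where
  split : Σ (Fin (suc k)) (Fin ∘ c) ↔ (Fin (c zero) ⊎ Σ (Fin k) (Fin ∘ c ∘ suc))
  split = mk↔ₛ′ (λ { (zero , i) → inj₁ i ; (suc x , i) → inj₂ (x , i) })
                (λ { (inj₁ i) → zero , i ; (inj₂ (x , i)) → suc x , i })
                (λ { (inj₁ _) → refl ; (inj₂ _) → refl })
                (λ { (zero , _) → refl ; (suc _ , _) → refl })

Word-∷-↔ : ∀ {n k} {P : Word (suc n) k → Set} →
  [ w ∈ Word (suc n) k ∣ P w ] ↔ Σ (Fin k) λ x → [ w ∈ Word n k ∣ P (x ∷ w) ]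
Word-∷-↔ = mk↔ₛ′ (λ { (x ∷ w , p) → x , (w , p) }) (λ { (x , (w , p)) → x ∷ w , p })
                 (λ _ → refl) (λ { (_ ∷ _ , _) → refl })

count-↔ : ∀ n k {P : Word n k → Set} (P? : Decidable P) →
  [ w ∈ Word n k ∣ P w ] ↔ Fin (length (filter P? (allWords n k)))
count-↔ zero k P? with P? []
... | yes p = mk↔ₛ′ (λ _ → zero) (λ _ → [] , [ p ]) (λ { zero → refl }) (λ { ([] , _) → refl })
... | no ¬p = mk↔ₛ′ (λ { ([] , [ p ]) → ⊥-elim-irr (¬p p) }) (λ ()) (λ ())
                    (λ { ([] , [ p ]) → ⊥-elim-irr (¬p p) })
count-↔ (suc n) k P? = subst (λ m → _ ↔ Fin m) (sym (length-filter-allWords-suc n k P?))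
  (↔-trans Word-∷-↔ (↔-trans (Σ-↔ ↔-refl λ {x} → count-↔ n k (P? ∘ (x ∷_))) (Σ-Fin-↔ _)))

stirling1-above : ∀ n j → n ℕ.< j → stirling1 n j ≡ 0
stirling1-above zero    (suc j) _         = refl
stirling1-above (suc n) (suc j) (s<s n<j) = begin
  n * stirling1 n (suc j) + stirling1 n j
    ≡⟨ cong₂ (λ a b → n * a + b) (stirling1-above n (suc j) (ℕₚ.m<n⇒m<1+n n<j))
                                 (stirling1-above n j n<j) ⟩
  n * 0 + 0 ≡⟨ cong (_+ 0) (ℕₚ.*-zeroʳ n) ⟩
  0         ∎
  where open ≡-Reasoning

stirling1-diag : ∀ n → stirling1 n n ≡ 1
stirling1-diag zero    = refl
stirling1-diag (suc n) = begin
  n * stirling1 n (suc n) + stirling1 n n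
    ≡⟨ cong₂ (λ a b → n * a + b) (stirling1-above n (suc n) (ℕₚ.n<1+n n)) (stirling1-diag n) ⟩
  n * 0 + 1 ≡⟨ cong (_+ 1) (ℕₚ.*-zeroʳ n) ⟩
  1         ∎
  where open ≡-Reasoning

-- For k > n both sides are 0.
stirling1-suc-∸ : ∀ n k →
  stirling1 (suc (suc n)) (suc n ∸ k) ≡ stirling1 (suc n) (n ∸ k) + suc n * stirling1 (suc n) (suc n ∸ k)
stirling1-suc-∸ n k with k ℕ.≤? n
... | yes k≤n rewrite ℕₚ.+-∸-assoc 1 k≤n = ℕₚ.+-comm (suc n * stirling1 (suc n) (suc (n ∸ k))) _
... | no k≰n
  rewrite ℕₚ.m≤n⇒m∸n≡0 (ℕₚ.≰⇒> k≰n)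
        | ℕₚ.m≤n⇒m∸n≡0 (ℕₚ.<⇒≤ (ℕₚ.≰⇒> k≰n)) = sym (ℕₚ.*-zeroʳ n)

-- Occurrences of 010

StrictMinimumAt : ∀ {n K} → Word n K → Fin n → Set
StrictMinimumAt v i = ∀ j → i ≢ j → lookup v i < lookup v j

-- No occurrence of 010 passes through a strict minimum, and f is strict on an
-- occurrence because equal positions carry equal letters.
Contains010-reindex : ∀ {m n K} (u : Word m K) (v : Word n K) (f : Fin n → Fin m) →
  Monotonic₁ _≤_ _≤_ f → (∀ i → lookup v i ≡ lookup u (f i) ⊎ StrictMinimumAt v i) → Contains010 v → Contains010 u
Contains010-reindex u v f f-mono agree (a , b , c , a<b , b<c , va≡vc , va<vb) =
  f a , f b , f c , fa<fb , fb<fc , ua≡uc , ua<ub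
  where
  agree-at : ∀ i → ¬ StrictMinimumAt v i → lookup v i ≡ lookup u (f i)
  agree-at i ¬min with agree i
  ... | inj₁ vi≡ui = vi≡ui
  ... | inj₂ min   = ⊥-elim (¬min min)
  a≢c : a ≢ c
  a≢c = <⇒≢ (<-trans a<b b<c)
  va≡ua : lookup v a ≡ lookup u (f a)
  va≡ua = agree-at a λ min → <-irrefl va≡vc (min c a≢c)
  vb≡ub : lookup v b ≡ lookup u (f b)
  vb≡ub = agree-at b λ min → <-asym va<vb (min a (≢-sym (<⇒≢ a<b)))
  vc≡uc : lookup v c ≡ lookup u (f c)
  vc≡uc = agree-at c λ min → <-irrefl (sym va≡vc) (min a (≢-sym a≢c))
  ua≡uc : lookup u (f a) ≡ lookup u (f c)
  ua≡uc = trans (sym va≡ua) (trans va≡vc vc≡uc)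
  ua<ub : lookup u (f a) < lookup u (f b)
  ua<ub = subst₂ _<_ va≡ua vb≡ub va<vb
  fa<fb : f a < f b
  fa<fb = ≤∧≢⇒< (f-mono (ℕₚ.<⇒≤ a<b)) λ fa≡fb → <⇒≢ ua<ub (cong (lookup u) fa≡fb)
  fb<fc : f b < f c
  fb<fc = ≤∧≢⇒< (f-mono (ℕₚ.<⇒≤ b<c)) λ fb≡fc →
    <⇒≢ ua<ub (trans ua≡uc (cong (lookup u) (sym fb≡fc)))

Contains010-map-suc⁺ : ∀ {n K} (w : Word n K) → Contains010 w → Contains010 (map Fin.suc w)
Contains010-map-suc⁺ w (a , b , c , a<b , b<c , wa≡wc , wa<wb) =
  a , b , c , a<b , b<c ,
  trans (lookup-map a Fin.suc w) (trans (cong suc wa≡wc) (sym (lookup-map c Fin.suc w))) ,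
  subst₂ _<_ (sym (lookup-map a Fin.suc w)) (sym (lookup-map b Fin.suc w)) (s<s wa<wb)

Contains010-map-suc⁻ : ∀ {n K} (w : Word n K) → Contains010 (map Fin.suc w) → Contains010 w
Contains010-map-suc⁻ w (a , b , c , a<b , b<c , wa≡wc , wa<wb) =
  a , b , c , a<b , b<c ,
  suc-injective (trans (sym (lookup-map a Fin.suc w)) (trans wa≡wc (lookup-map c Fin.suc w))) ,
  ℕ.s<s⁻¹ (subst₂ _<_ (lookup-map a Fin.suc w) (lookup-map b Fin.suc w) wa<wb)

lookup-insertAt-inject₁ : ∀ {A : Set} {m} (xs : Vec A m) q j →
  lookup (insertAt xs (inject₁ q) (lookup xs q)) j ≡ lookup xs (pinch q j)
lookup-insertAt-inject₁ (x ∷ xs) zero    zero    = refl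
lookup-insertAt-inject₁ (x ∷ xs) zero    (suc j) = refl
lookup-insertAt-inject₁ (x ∷ xs) (suc q) zero    = refl
lookup-insertAt-inject₁ (x ∷ xs) (suc q) (suc j) = lookup-insertAt-inject₁ xs q j

lookup-insertAt-suc : ∀ {A : Set} {m} (xs : Vec A m) q y {j} → suc q ≢ j →
  lookup (insertAt xs (suc q) y) j ≡ lookup xs (pinch q j)
lookup-insertAt-suc (x ∷ xs) q       y {zero}        _   = refl
lookup-insertAt-suc (x ∷ xs) zero    y {suc zero}    q≢j = ⊥-elim (q≢j refl)
lookup-insertAt-suc (x ∷ xs) zero    y {suc (suc j)} _   = refl
lookup-insertAt-suc (x ∷ xs) (suc q) y {suc j}       q≢j = lookup-insertAt-suc xs q y (q≢j ∘ cong suc)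

Avoids010-insertAt⁻ : ∀ {m K} (u : Word m K) p x → Avoids010 (insertAt u p x) → Avoids010 u
Avoids010-insertAt⁻ u p x av = av ∘ Contains010-reindex (insertAt u p x) u (punchIn p) (punchIn-mono-≤ p _ _)
  (λ i → inj₁ (sym (insertAt-punchIn u p x i)))

Avoids010-duplicate : ∀ {m K} (u : Word m K) q → Avoids010 u → Avoids010 (insertAt u (inject₁ q) (lookup u q))
Avoids010-duplicate u q av =
  av ∘ Contains010-reindex u (insertAt u (inject₁ q) (lookup u q)) (pinch q) (pinch-mono-≤ q)
         (inj₁ ∘ lookup-insertAt-inject₁ u q)

Avoids010-insertAt-fresh-zero : ∀ {m K} (w : Word m K) q →
  Avoids010 w → Avoids010 (insertAt (map Fin.suc w) (suc q) zero)
Avoids010-insertAt-fresh-zero w q av =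
  av ∘ Contains010-map-suc⁻ w ∘ Contains010-reindex (map Fin.suc w) v (pinch q) (pinch-mono-≤ q) agree
  where
  v : Word _ _
  v = insertAt (map Fin.suc w) (suc q) zero
  agree : ∀ i → lookup v i ≡ lookup (map Fin.suc w) (pinch q i) ⊎ StrictMinimumAt v i
  agree i with suc q ≟ i
  ... | no q≢i   = inj₁ (lookup-insertAt-suc (map Fin.suc w) q zero q≢i)
  ... | yes refl = inj₂ λ j q≢j →
    subst₂ _<_ (sym (insertAt-lookup (map Fin.suc w) (suc q) zero))
               (sym (trans (lookup-insertAt-suc (map Fin.suc w) q zero q≢j) (lookup-map (pinch q j) Fin.suc w)))
               z<s

infix 4 _occursIn_
_occursIn_ : ∀ {n K} → Fin K → Word n K → Set
x occursIn w = ∃ λ i → lookup w i ≡ x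

Surjective-insertAt : ∀ {m K} (u : Word m K) p x → Surjective u → Surjective (insertAt u p x)
Surjective-insertAt u p x onto = Product.map (punchIn p) (λ {i} → trans (insertAt-punchIn u p x i)) ∘ onto

occurs-insertAt⁻ : ∀ {m K} (u : Word m K) p x {y} → y occursIn insertAt u p x → y ≢ x → y occursIn u
occurs-insertAt⁻ u p x (i , vi≡y) y≢x with p ≟ i
... | yes refl = ⊥-elim (y≢x (trans (sym vi≡y) (insertAt-lookup u p x)))
... | no p≢i   = punchOut p≢i , (begin
  lookup u (punchOut p≢i)                             ≡⟨ insertAt-punchIn u p x (punchOut p≢i) ⟨
  lookup (insertAt u p x) (punchIn p (punchOut p≢i))  ≡⟨ cong (lookup (insertAt u p x)) (punchIn-punchOut p≢i) ⟩
  lookup (insertAt u p x) i                           ≡⟨ vi≡y ⟩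
  _                                                   ∎)
  where open ≡-Reasoning

zero∉map-suc : ∀ {m K} (w : Word m K) → ¬ zero occursIn map Fin.suc w
zero∉map-suc w (j , e) = 0≢1+n (trans (sym e) (lookup-map j Fin.suc w))

zero-free⇒map-suc : ∀ {m K} (u : Word m (suc K)) → ¬ zero occursIn u → ∃ λ w → u ≡ map Fin.suc w
zero-free⇒map-suc []          _  = [] , refl
zero-free⇒map-suc (zero  ∷ u) ∄0 = ⊥-elim (∄0 (zero , refl))
zero-free⇒map-suc (suc x ∷ u) ∄0 =
  Product.map (x ∷_) (cong (suc x ∷_)) (zero-free⇒map-suc u (∄0 ∘ Product.map Fin.suc id))

map-suc-injective : ∀ {m K} {w w′ : Word m K} → map Fin.suc w ≡ map Fin.suc w′ → w ≡ w′
map-suc-injective {w = []}    {[]}    _  = refl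
map-suc-injective {w = _ ∷ _} {_ ∷ _} eq =
  cong₂ _∷_ (suc-injective (∷-injectiveˡ eq)) (map-suc-injective (∷-injectiveʳ eq))

-- The position of the first 0, or the length of the word if 0 does not occur.
firstZero : ∀ {m K} → Word m (suc K) → Fin (suc m)
firstZero []          = zero
firstZero (zero  ∷ _) = zero
firstZero (suc _ ∷ u) = suc (firstZero u)

firstZero-insertAt : ∀ {m K} (u : Word m (suc K)) p → p ≤ firstZero u →
  firstZero (insertAt u p zero) ≡ inject₁ p
firstZero-insertAt u           zero    _        = refl
firstZero-insertAt (suc _ ∷ u) (suc p) (s≤s p≤) = cong suc (firstZero-insertAt u p p≤)

firstZero-map-suc : ∀ {m K} (w : Word m K) → firstZero (map Fin.suc w) ≡ fromℕ m
firstZero-map-suc []      = refl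
firstZero-map-suc (_ ∷ w) = cong suc (firstZero-map-suc w)

firstZero-inject₁ : ∀ {m K} (u : Word m (suc K)) → zero occursIn u →
  ∃ λ q → firstZero u ≡ inject₁ q × lookup u q ≡ zero
firstZero-inject₁ (zero  ∷ _) _              = zero , refl , refl
firstZero-inject₁ (suc _ ∷ u) (suc j , uj≡0) with firstZero-inject₁ u (j , uj≡0)
... | q , fz≡q , uq≡0 = suc q , cong suc fz≡q , uq≡0

∃insertAt-zero : ∀ {m K} (v : Word (suc m) (suc K)) → zero occursIn v →
  ∃₂ λ u p → p ≤ firstZero u × v ≡ insertAt u p zero
∃insertAt-zero         (zero  ∷ v) _              = v , zero , z≤n , refl
∃insertAt-zero {suc m} (suc x ∷ v) (suc j , vj≡0) with ∃insertAt-zero v (j , vj≡0)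
... | u , p , p≤ , refl = suc x ∷ u , suc p , s≤s p≤ , refl

insertAt-zero-injective : ∀ {m K} {u u′ : Word m (suc K)} {p p′} →
  p ≤ firstZero u → p′ ≤ firstZero u′ → insertAt u p zero ≡ insertAt u′ p′ zero → p ≡ p′ × u ≡ u′
insertAt-zero-injective {u = u} {u′} {p} {p′} p≤ p′≤ eq = p≡p′ , (begin
  u                                  ≡⟨ removeAt-insertAt u p zero ⟨
  removeAt (insertAt u p zero) p     ≡⟨ cong₂ removeAt eq p≡p′ ⟩
  removeAt (insertAt u′ p′ zero) p′  ≡⟨ removeAt-insertAt u′ p′ zero ⟩
  u′                                 ∎)
  where
  open ≡-Reasoning
  p≡p′ : p ≡ p′
  p≡p′ = inject₁-injective (begin
    inject₁ p                        ≡⟨ firstZero-insertAt u p p≤ ⟨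
    firstZero (insertAt u p zero)    ≡⟨ cong firstZero eq ⟩
    firstZero (insertAt u′ p′ zero)  ≡⟨ firstZero-insertAt u′ p′ p′≤ ⟩
    inject₁ p′                       ∎)

-- Since 0 is the smallest letter, the zeros of a 010-avoiding word are
-- consecutive: a 0 inserted no later than the first 0 must sit right before it.
Avoids010-insertAt⇒firstZero≡ : ∀ {m K} (u : Word m (suc K)) p →
  Avoids010 (insertAt u p zero) → p ≤ firstZero u → zero occursIn u → firstZero u ≡ p
Avoids010-insertAt⇒firstZero≡ (zero  ∷ _) zero    _  _        _              = refl
Avoids010-insertAt⇒firstZero≡ (suc _ ∷ u) zero    av _        (suc j , uj≡0) =
  ⊥-elim (av (zero , suc zero , suc (suc j) , z<s , s<s z<s , sym uj≡0 , z<s))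
Avoids010-insertAt⇒firstZero≡ (suc x ∷ u) (suc p) av (s≤s p≤) (suc j , uj≡0) =
  cong suc (Avoids010-insertAt⇒firstZero≡ u p (Avoids010-insertAt⁻ _ zero (suc x) av) p≤ (j , uj≡0))

Avoids010-insertAt-firstZero : ∀ {m K} (u : Word m (suc K)) → zero occursIn u →
  Avoids010 u → Avoids010 (insertAt u (firstZero u) zero)
Avoids010-insertAt-firstZero u zero∈u av with firstZero-inject₁ u zero∈u
... | q , fz≡q , uq≡0 = subst Avoids010 (cong₂ (insertAt u) (sym fz≡q) uq≡0) (Avoids010-duplicate u q av)

InA-insertAt-firstZero : ∀ {n k} (u : Word (suc n) (suc (suc k))) →
  InA n (suc k) u → InA (suc n) (suc k) (insertAt u (firstZero u) zero)
InA-insertAt-firstZero (zero ∷ _)      (_ , _ , ())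
InA-insertAt-firstZero u@(suc _ ∷ _) (av , onto , head) =
  Avoids010-insertAt-firstZero u (onto zero) av , Surjective-insertAt u (firstZero u) zero onto , head

InA-insertAt-fresh-zero : ∀ {n k} (w : Word (suc n) (suc k)) q →
  InA n k w → InA (suc n) (suc k) (insertAt (map Fin.suc w) (suc q) zero)
InA-insertAt-fresh-zero w@(_ ∷ _) q (av , onto , head) =
  Avoids010-insertAt-fresh-zero w q av , onto′ , cong suc head
  where
  onto′ : Surjective (insertAt (map Fin.suc w) (suc q) zero)
  onto′ zero    = suc q , insertAt-lookup (map Fin.suc w) (suc q) zero
  onto′ (suc y) = let i , wi≡y = onto y in
    punchIn (suc q) i ,
    trans (insertAt-punchIn (map Fin.suc w) (suc q) zero i) (trans (lookup-map i Fin.suc w) (cong suc wi≡y))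

InA-insertAt-zero⁻ : ∀ {n k} (u : Word (suc n) (suc (suc k))) q → zero occursIn u →
  InA (suc n) (suc k) (insertAt u (suc q) zero) → InA n (suc k) u
InA-insertAt-zero⁻ u@(_ ∷ _) q zero∈u (av , onto , head) =
  Avoids010-insertAt⁻ u (suc q) zero av , onto′ , head
  where
  onto′ : Surjective u
  onto′ zero    = zero∈u
  onto′ (suc y) = occurs-insertAt⁻ u (suc q) zero (onto (suc y)) λ ()

InA-insertAt-fresh-zero⁻ : ∀ {n k} (w : Word (suc n) (suc k)) q →
  InA (suc n) (suc k) (insertAt (map Fin.suc w) (suc q) zero) → InA n k w
InA-insertAt-fresh-zero⁻ w@(_ ∷ _) q (av , onto , head) =
  Avoids010-insertAt⁻ (map Fin.suc w) (suc q) zero av ∘ Contains010-map-suc⁺ w , onto′ , suc-injective head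
  where
  onto′ : Surjective w
  onto′ y = Product.map₂ (λ {i} wi≡y → suc-injective (trans (sym (lookup-map i Fin.suc w)) wi≡y))
                         (occurs-insertAt⁻ (map Fin.suc w) (suc q) zero (onto (suc y)) λ ())

-- The bijection behind the recurrence

-- The membership proof is irrelevant, so elements of 𝔄 are equal as soon as
-- their words are.
𝔄 : ℕ → ℕ → Set
𝔄 n k = [ w ∈ Word (suc n) (suc k) ∣ InA n k w ]

Split : ℕ → ℕ → Set
Split n k = 𝔄 n (suc k) ⊎ (Fin (suc n) × 𝔄 n k)

module _ {n k : ℕ} where

  base : Split n k → Word (suc n) (suc (suc k))
  base (inj₁ (u , _))       = u
  base (inj₂ (_ , (w , _))) = map Fin.suc w

  slot : Split n k → Fin (suc (suc n))
  slot (inj₁ (u , _)) = firstZero u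
  slot (inj₂ (q , _)) = suc q

  slot≤firstZero : ∀ x → slot x ≤ firstZero (base x)
  slot≤firstZero (inj₁ _)             = ≤-refl
  slot≤firstZero (inj₂ (q , (w , _))) = subst (suc q ≤_) (sym (firstZero-map-suc w)) (≤fromℕ (suc q))

  InA-merge : ∀ x → Irrelevant (InA (suc n) (suc k) (insertAt (base x) (slot x) zero))
  InA-merge (inj₁ (u , u∈))       = Irrelevant.map (InA-insertAt-firstZero u) u∈
  InA-merge (inj₂ (q , (w , w∈))) = Irrelevant.map (InA-insertAt-fresh-zero w q) w∈

  merge : Split n k → 𝔄 (suc n) (suc k)
  merge x = insertAt (base x) (slot x) zero , InA-merge x

  Split-≡ : ∀ x y → slot x ≡ slot y → base x ≡ base y → x ≡ y
  Split-≡ (inj₁ _) (inj₁ _) _ u≡u′ = cong inj₁ (value-injective u≡u′)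
  Split-≡ (inj₂ _) (inj₂ _) q≡q′ w≡w′ =
    cong₂ (λ q w → inj₂ (q , w)) (suc-injective q≡q′) (value-injective (map-suc-injective w≡w′))
  Split-≡ (inj₁ (u , [ u∈ ])) (inj₂ (_ , (w , _))) _ u≡w =
    ⊥-elim-irr (zero∉map-suc w (subst (zero occursIn_) u≡w (proj₁ (proj₂ u∈) zero)))
  Split-≡ (inj₂ (_ , (w , _))) (inj₁ (u , [ u∈ ])) _ w≡u =
    ⊥-elim-irr (zero∉map-suc w (subst (zero occursIn_) (sym w≡u) (proj₁ (proj₂ u∈) zero)))

  merge-injective : Injective _≡_ _≡_ merge
  merge-injective {x} {y} eq =
    Product.uncurry (Split-≡ x y) (insertAt-zero-injective (slot≤firstZero x) (slot≤firstZero y) (cong value eq))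

  merge-preimage : ∀ (u : Word (suc n) (suc (suc k))) p → p ≤ firstZero u →
    InA (suc n) (suc k) (insertAt u p zero) → ∃ λ x → value (merge x) ≡ insertAt u p zero
  merge-preimage u zero    _  (_ , _ , ())
  merge-preimage u (suc q) p≤ v∈ with any? (λ i → lookup u i ≟ zero)
  ... | yes zero∈u = inj₁ (u , [ InA-insertAt-zero⁻ u q zero∈u v∈ ]) ,
    cong (λ p → insertAt u p zero) (Avoids010-insertAt⇒firstZero≡ u (suc q) (proj₁ v∈) p≤ zero∈u)
  ... | no ∄0 with zero-free⇒map-suc u ∄0
  ...   | w , refl = inj₂ (q , (w , [ InA-insertAt-fresh-zero⁻ w q v∈ ])) , refl

  merge-strictlySurjective : StrictlySurjective _≡_ merge
  merge-strictlySurjective (v , [ v∈ ]) =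
    Product.map₂ value-injective (preimage v (recompute (inA? (suc n) (suc k) v) v∈))
    where
    preimage : ∀ v → InA (suc n) (suc k) v → ∃ λ x → value (merge x) ≡ v
    preimage v v∈ with ∃insertAt-zero v (proj₁ (proj₂ v∈) zero)
    ... | u , p , p≤ , refl = merge-preimage u p p≤ v∈

𝔄-suc-↔ : ∀ {n k} → 𝔄 (suc n) (suc k) ↔ Split n k
𝔄-suc-↔ = ↔-sym (⤖⇒↔ (mk⤖ (merge-injective , strictlySurjective⇒surjective merge-strictlySurjective)))

𝔄↔Fin-countA : ∀ n k → 𝔄 n k ↔ Fin (countA n k)
𝔄↔Fin-countA n k = count-↔ (suc n) (suc k) (inA? n k)

countA-suc : ∀ n k → countA (suc n) (suc k) ≡ countA n (suc k) + suc n * countA n k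
countA-suc n k = ↔⇒≡ (begin
  Fin (countA (suc n) (suc k))                                  ↔⟨ ↔-sym (𝔄↔Fin-countA (suc n) (suc k)) ⟩
  𝔄 (suc n) (suc k)                                             ↔⟨ 𝔄-suc-↔ ⟩
  (𝔄 n (suc k) ⊎ (Fin (suc n) × 𝔄 n k))
    ↔⟨ 𝔄↔Fin-countA n (suc k) ⊎-↔ (↔-refl ×-↔ 𝔄↔Fin-countA n k) ⟩
  (Fin (countA n (suc k)) ⊎ (Fin (suc n) × Fin (countA n k)))  ↔⟨ ↔-refl ⊎-↔ ↔-sym *↔× ⟩
  (Fin (countA n (suc k)) ⊎ Fin (suc n * countA n k))          ↔⟨ ↔-sym +↔⊎ ⟩
  Fin (countA n (suc k) + suc n * countA n k)                   ∎)
  where open Related.EquationalReasoning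

unary-word-unique : ∀ {m} (w : Word m 1) → w ≡ replicate m zero
unary-word-unique []         = refl
unary-word-unique (zero ∷ w) = cong (zero ∷_) (unary-word-unique w)

InA-unary : ∀ {n} (w : Word (suc n) 1) → InA n 0 w
InA-unary w = (λ (a , b , _ , _ , _ , _ , wa<wb) → <⇒≢ wa<wb (unary-letter-unique (lookup w a) (lookup w b))) ,
              (λ { zero → zero , unary-letter-unique _ _ }) ,
              unary-letter-unique _ _
  where
  unary-letter-unique : (x y : Fin 1) → x ≡ y
  unary-letter-unique zero zero = refl

countA-unary : ∀ n → countA n 0 ≡ 1
countA-unary n = ↔⇒≡ (↔-trans (↔-sym (𝔄↔Fin-countA n 0)) (↔-trans 𝔄-unary-↔⊤ (↔-sym 1↔⊤)))
  where
  ω : Word (suc n) 1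
  ω = replicate (suc n) zero
  𝔄-unary-↔⊤ : 𝔄 n 0 ↔ ⊤
  𝔄-unary-↔⊤ = mk↔ₛ′ _ (λ _ → ω , [ InA-unary ω ]) (λ _ → refl)
                     (λ w → value-injective (sym (unary-word-unique (value w))))

¬InA-singleton : ∀ {k} (w : Word 1 (suc (suc k))) → ¬ InA 0 (suc k) w
¬InA-singleton (x ∷ []) (_ , onto , head) with onto zero
... | zero , x≡0 = 0≢1+n (trans (sym x≡0) head)

countA-singleton : ∀ k → countA 0 (suc k) ≡ 0
countA-singleton k =
  cong length (filter-none (inA? 0 (suc k)) {allWords 1 (suc (suc k))} (All.tabulate λ {w} _ → ¬InA-singleton w))

countA≡stirling1 : ∀ n k → countA n k ≡ stirling1 (suc n) (suc n ∸ k)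
countA≡stirling1 n       zero    = trans (countA-unary n) (sym (stirling1-diag (suc n)))
countA≡stirling1 zero    (suc k) = trans (countA-singleton k) (cong (stirling1 1) (sym (ℕₚ.0∸n≡0 k)))
countA≡stirling1 (suc n) (suc k) = begin
  countA (suc n) (suc k)                                             ≡⟨ countA-suc n k ⟩
  countA n (suc k) + suc n * countA n k
    ≡⟨ cong₂ (λ a b → a + suc n * b) (countA≡stirling1 n (suc k)) (countA≡stirling1 n k) ⟩
  stirling1 (suc n) (n ∸ k) + suc n * stirling1 (suc n) (suc n ∸ k)  ≡⟨ stirling1-suc-∸ n k ⟨
  stirling1 (suc (suc n)) (suc n ∸ k)                                ∎
  where open ≡-Reasoning

lemma1 : ∀ (n' k' : ℕ) → countA n' k' ≡ stirling1 (suc n') (suc n' + 1 ∸ suc k')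
lemma1 n' k' = trans (countA≡stirling1 n' k') (cong (λ m → stirling1 (suc n') (m ∸ k')) (ℕₚ.+-comm 1 n'))
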